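{- Let $d$ be a positive integer and let $\Gamma$ be a finite, simple, strongly connected digraph with $\dim(\Gamma)=1$ and diameter $d$. Then (i) $\Gamma$ is isomorphic to a subdigraph of $\Gamma(d^2+1,d)$; (ii) $d+1\leq |V(\Gamma)|\leq d^2+1$; (iii) $d+1\leq |A(\Gamma)|\leq \big(\frac{d^2+3d-2}{2}\big)^2+d(2-d)$.
   Context: $\partial(x,y)$ is the length of a shortest directed path from $x$ to $y$, $\tilde\partial(x,y)=(\partial(x,y),\partial(y,x))$, diameter is $\max_{x,y}\partial(x,y)$. A set $\{w_1,\dots,w_m\}$ of vertices is weakly resolving if $(\tilde\partial(w_1,u),\dots,\tilde\partial(w_m,u))\neq(\tilde\partial(w_1,v),\dots,\tilde\partial(w_m,v))$ for all distinct $u,v$; $\dim(\Gamma)$ is the minimum size of such a set. $\Gamma(d^2+1,d)$ is the digraph with vertex set $\{u_1\}\cup\{1,\dots,d\}^2$ and arcs exactly: $(u_1,(a_1,a_2))$ whenever $a_1=1$; $((a_1,a_2),u_1)$ whenever $a_2=1$; $((a_1,a_2),(b_1,b_2))$ whenever $(a_1,a_2)\neq(b_1,b_2)$, $a_1-b_1\geq -1$ and $a_2-b_2\leq 1$. "Isomorphic to a subdigraph" means there is an injective vertex map sending arcs to arcs. -}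

module Defs where

open import Data.Nat using (ℕ; zero; suc; _+_; _*_; _≤_; _<_)
open import Data.Bool using (Bool; true; false; T; if_then_else_)
open import Data.Fin using (Fin; toℕ)
open import Data.Maybe using (Maybe; just; nothing)
open import Data.Product using (Σ; ∃; ∃-syntax; _×_; _,_)
open import Data.Empty using (⊥)
open import Data.List using (List; length; map; allFin)
open import Data.Nat.ListAction using (sum)
open import Data.List.Membership.Propositional using (_∈_)
open import Data.List.Relation.Unary.Unique.Propositional using (Unique)
open import Relation.Nullary using (¬_)
open import Relation.Binary.PropositionalEquality using (_≡_; _≢_)
open import Function.Bundles using (_⇔_)
open import Function.Definitions using (Injective)

-- A finite simple digraph: vertex set Fin n, adjacency given by a Boolean
-- relation (so at most one arc x → y), and no loops.
record Digraph : Set where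
  field
    n        : ℕ
    adj      : Fin n → Fin n → Bool
    loopless : ∀ x → adj x x ≡ false

open Digraph public

V : Digraph → Set
V G = Fin (n G)

Arc : (G : Digraph) → V G → V G → Set
Arc G x y = T (adj G x y)

data Walk (G : Digraph) : V G → V G → ℕ → Set where
  nil  : ∀ {x} → Walk G x x 0
  cons : ∀ {x z y k} → Arc G x z → Walk G z y k → Walk G x y (suc k)

Dist : (G : Digraph) → V G → V G → ℕ → Set
Dist G x y k = Walk G x y k × (∀ m → m < k → ¬ Walk G x y m)

StronglyConnected : Digraph → Set
StronglyConnected G = ∀ x y → ∃[ k ] Walk G x y k

HasDiameter : Digraph → ℕ → Set
HasDiameter G d =
  (∀ x y → ∃[ k ] (Dist G x y k × k ≤ d)) × (∃[ x ] ∃[ y ] Dist G x y d)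

SameDistPair : (G : Digraph) → V G → V G → V G → Set
SameDistPair G w u v =
  (∀ k → Dist G w u k ⇔ Dist G w v k) × (∀ k → Dist G u w k ⇔ Dist G v w k)

WeaklyResolving : (G : Digraph) → List (V G) → Set
WeaklyResolving G W =
  ∀ u v → u ≢ v → ¬ (∀ w → w ∈ W → SameDistPair G w u v)

HasDim : Digraph → ℕ → Set
HasDim G m =
  (∃[ W ] (Unique W × WeaklyResolving G W × length W ≡ m)) ×
  (∀ W → Unique W → WeaklyResolving G W → m ≤ length W)

arcCount : Digraph → ℕ
arcCount G =
  sum (map (λ x → sum (map (λ y → if adj G x y then 1 else 0) (allFin (n G))))
           (allFin (n G)))

-- The digraph Γ(d²+1,d): vertex u₁ = nothing, (a₁,a₂) ∈ {1..d}² encoded as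
-- just (i₁,i₂) with aⱼ = toℕ iⱼ + 1.
GammaV : ℕ → Set
GammaV d = Maybe (Fin d × Fin d)

GammaArc : (d : ℕ) → GammaV d → GammaV d → Set
GammaArc d nothing nothing = ⊥
GammaArc d nothing (just (a₁ , a₂)) = toℕ a₁ ≡ 0
GammaArc d (just (a₁ , a₂)) nothing = toℕ a₂ ≡ 0
GammaArc d (just (a₁ , a₂)) (just (b₁ , b₂)) =
  ((a₁ , a₂) ≢ (b₁ , b₂)) ×
  (toℕ b₁ ≤ suc (toℕ a₁)) ×                                   -- a₁ - b₁ ≥ -1
  (toℕ a₂ ≤ suc (toℕ b₂))                                     -- a₂ - b₂ ≤ 1

EmbedsInGamma : Digraph → ℕ → Set
EmbedsInGamma G d =
  Σ (V G → GammaV d) λ f →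
    Injective _≡_ _≡_ f × (∀ x y → Arc G x y → GammaArc d (f x) (f y))

module Submission where

-- Let w be the vertex forming a weakly resolving set. Its profile x ↦ (∂(w,x), ∂(x,w)) is injective,
-- equals (0 , 0) only at w and lies in [1 , d]² elsewhere, and by the triangle inequality an arc x → y
-- gives ∂(w,y) ≤ ∂(w,x) + 1 and ∂(x,w) ≤ ∂(y,w) + 1: exactly the arc rule of Γ(d²+1,d), which is (i).
-- The upper bounds of (ii) and (iii) hold for every subdigraph of Γ(d²+1,d). For arcs: the images of
-- the arcs together with the d² loops (v , v) at the non-hub vertices are distinct pairs, all inside a
-- list of d + d + c² candidates (the 2d arcs at u₁, and the pairs (a , b) with (a₁ , b₁) and (b₂ , a₂)
-- in the band b ≤ a + 1 of c elements), so |A| + d² ≤ 2d + c². The lower bounds come from a diametral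
-- path, whose d + 1 vertices are distinct, and from every vertex having an out-neighbour.

open import Defs
open import Data.Bool using (Bool; true; false; T; if_then_else_)
open import Data.Empty using (⊥-elim)
open import Data.Fin using (Fin; toℕ; fromℕ<)
open import Data.Fin.Properties using (toℕ≤pred[n]; toℕ<n; toℕ-fromℕ<; toℕ-injective; injective⇒≤)
  renaming (_≟_ to _≟ᶠ_)
open import Data.Integer using (+_; +≤+)
  renaming (_+_ to _+ℤ_; _*_ to _*ℤ_; _-_ to _-ℤ_; -_ to -ℤ_; _≤_ to _≤ℤ_)
import Data.Integer.Properties as ℤ
open import Data.Integer.Tactic.RingSolver renaming (solve-∀ to ℤsolve-∀)
open import Data.List using (List; []; _∷_; length; map; filterᵇ; cartesianProduct; _++_; upTo; allFin)
open import Data.List.Properties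
  using (length-++; length-++-sucʳ; filter-++; map-∘; length-map; length-tabulate; length-upTo)
open import Data.List.Membership.Propositional using (_∈_)
open import Data.List.Membership.Propositional.Properties
  using ( ∈-∃++; ∈-++⁻; ∈-++⁺ˡ; ∈-++⁺ʳ; ∈-map⁺; ∈-map⁻; ∈-filter⁺; ∈-filter⁻
        ; ∈-cartesianProduct⁺; ∈-allFin; ∈-upTo⁺)
open import Data.List.Relation.Binary.Disjoint.Propositional using (Disjoint)
open import Data.List.Relation.Binary.Subset.Propositional using (_⊆_)
open import Data.List.Relation.Unary.All using (lookup)
open import Data.List.Relation.Unary.AllPairs using ([]; _∷_)
open import Data.List.Relation.Unary.Any using (here; there)
open import Data.List.Relation.Unary.Unique.Propositional using (Unique)
import Data.List.Relation.Unary.Unique.Propositional.Properties as Unique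
open import Data.Maybe using (just; nothing)
open import Data.Maybe.Properties using (just-injective)
open import Data.Nat using (ℕ; zero; suc; _+_; _*_; _∸_; _≤_; _<_; z≤n; s≤s; s≤s⁻¹)
open import Data.Nat.DivMod using (_/_; m*n/n≡m)
open import Data.Nat.ListAction using (sum)
open import Data.Nat.Properties
  using ( n≢0⇒n>0; m+n∸n≡m; +-comm; n≤1+n; suc-injective; n≤0⇒n≡0; ≮⇒≥; m+[n∸m]≡n; +-monoˡ-<
        ; ≤-trans; ≤-reflexive; ≤-antisym; m≤n⇒m<n∨m≡n; module ≤-Reasoning)
open import Data.Nat.Tactic.RingSolver using (solve-∀)
open import Data.Product using (∃-syntax; _×_; _,_; proj₁; proj₂; uncurry)
open import Data.Sum using (inj₁; inj₂)
open import Function.Base using (_∘_; id)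
open import Function.Bundles using (_⇔_; mk⇔)
open import Function.Definitions using (Injective)
open import Relation.Binary.Definitions using (DecidableEquality)
open import Relation.Binary.PropositionalEquality
open import Relation.Nullary using (¬_; yes; no)
open import Relation.Nullary.Decidable using (T?; decidable-stable)

module _ {A : Set} where

  length-mono-⊆ : {xs ys : List A} → Unique xs → xs ⊆ ys → length xs ≤ length ys
  length-mono-⊆ [] _ = z≤n
  length-mono-⊆ {x ∷ xs} (x∉xs ∷ xs!) xs⊆ys with ys₁ , ys₂ , refl ← ∈-∃++ (xs⊆ys (here refl)) =
    ≤-trans (s≤s (length-mono-⊆ xs! xs⊆ys₁++ys₂)) (≤-reflexive (sym (length-++-sucʳ ys₁ x ys₂)))
    where
    xs⊆ys₁++ys₂ : xs ⊆ ys₁ ++ ys₂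
    xs⊆ys₁++ys₂ {z} z∈xs with ∈-++⁻ ys₁ (xs⊆ys (there z∈xs))
    ... | inj₁ z∈ys₁ = ∈-++⁺ˡ z∈ys₁
    ... | inj₂ (here refl) = ⊥-elim (lookup x∉xs z∈xs refl)
    ... | inj₂ (there z∈ys₂) = ∈-++⁺ʳ ys₁ z∈ys₂

  sum-indicator≡length-filterᵇ : (p : A → Bool) (xs : List A) →
    sum (map (λ x → if p x then 1 else 0) xs) ≡ length (filterᵇ p xs)
  sum-indicator≡length-filterᵇ p [] = refl
  sum-indicator≡length-filterᵇ p (x ∷ xs) with p x
  ... | true = cong suc (sum-indicator≡length-filterᵇ p xs)
  ... | false = sum-indicator≡length-filterᵇ p xs

module _ {A B : Set} where

  length-cartesianProduct : (xs : List A) (ys : List B) →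
    length (cartesianProduct xs ys) ≡ length xs * length ys
  length-cartesianProduct [] ys = refl
  length-cartesianProduct (x ∷ xs) ys = begin
    length (map (x ,_) ys ++ cartesianProduct xs ys)   ≡⟨ length-++ (map (x ,_) ys) ⟩
    length (map (x ,_) ys) + length (cartesianProduct xs ys)
      ≡⟨ cong₂ _+_ (length-map (x ,_) ys) (length-cartesianProduct xs ys) ⟩
    length ys + length xs * length ys                 ∎
    where open ≡-Reasoning

  sum-indicator-pairs : (b : A → B → Bool) (xs : List A) (ys : List B) →
    sum (map (λ x → sum (map (λ y → if b x y then 1 else 0) ys)) xs) ≡
    length (filterᵇ (uncurry b) (cartesianProduct xs ys))
  sum-indicator-pairs b [] ys = refl
  sum-indicator-pairs b (x ∷ xs) ys = begin
    sum (map (λ y → if b x y then 1 else 0) ys) + _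
      ≡⟨ cong₂ _+_ (trans (cong sum (map-∘ ys)) (sum-indicator≡length-filterᵇ (uncurry b) (map (x ,_) ys)))
                   (sum-indicator-pairs b xs ys) ⟩
    length (filterᵇ (uncurry b) (map (x ,_) ys)) + length (filterᵇ (uncurry b) (cartesianProduct xs ys))
      ≡⟨ sym (length-++ (filterᵇ (uncurry b) (map (x ,_) ys))) ⟩
    length (filterᵇ (uncurry b) (map (x ,_) ys) ++ filterᵇ (uncurry b) (cartesianProduct xs ys))
      ≡⟨ cong length (sym (filter-++ _ (map (x ,_) ys) (cartesianProduct xs ys))) ⟩
    length (filterᵇ (uncurry b) (cartesianProduct (x ∷ xs) ys)) ∎
    where open ≡-Reasoning

length-allFin : ∀ m → length (allFin m) ≡ m
length-allFin m = length-tabulate id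

distinct⇒other : ∀ {A : Set} → DecidableEquality A → {x₀ y₀ : A} → x₀ ≢ y₀ → ∀ x → ∃[ y ] x ≢ y
distinct⇒other _≟_ {x₀} {y₀} x₀≢y₀ x with x ≟ x₀
... | yes refl = y₀ , x₀≢y₀
... | no x≢x₀  = x₀ , x≢x₀

arcs : (G : Digraph) → List (V G × V G)
arcs G = filterᵇ (uncurry (adj G)) (cartesianProduct (allFin (n G)) (allFin (n G)))

module _ (G : Digraph) where

  arcCount≡length-arcs : arcCount G ≡ length (arcs G)
  arcCount≡length-arcs = sum-indicator-pairs (adj G) (allFin (n G)) (allFin (n G))

  arcs-unique : Unique (arcs G)
  arcs-unique = Unique.filter⁺ _ (Unique.cartesianProduct⁺ (Unique.allFin⁺ (n G)) (Unique.allFin⁺ (n G)))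

  ∈-arcs⁺ : ∀ {x y} → Arc G x y → (x , y) ∈ arcs G
  ∈-arcs⁺ {x} {y} = ∈-filter⁺ (T? ∘ uncurry (adj G)) (∈-cartesianProduct⁺ (∈-allFin x) (∈-allFin y))

  ∈-arcs⁻ : ∀ {x y} → (x , y) ∈ arcs G → Arc G x y
  ∈-arcs⁻ = proj₂ ∘ ∈-filter⁻ (T? ∘ uncurry (adj G)) {xs = cartesianProduct (allFin (n G)) (allFin (n G))}

  Arc-irreflexive : ∀ {x} → ¬ Arc G x x
  Arc-irreflexive {x} = subst T (loopless G x)

  n≤arcCount : (∀ x → ∃[ y ] Arc G x y) → n G ≤ arcCount G
  n≤arcCount out = begin
    n G                                            ≡⟨ sym (length-allFin (n G)) ⟩
    length (allFin (n G))                           ≡⟨ sym (length-map outArc (allFin (n G))) ⟩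
    length (map outArc (allFin (n G)))              ≤⟨ length-mono-⊆ outArcs-unique outArcs⊆arcs ⟩
    length (arcs G)                                 ≡⟨ sym arcCount≡length-arcs ⟩
    arcCount G                                      ∎
    where
    open ≤-Reasoning
    outArc : V G → V G × V G
    outArc x = x , proj₁ (out x)
    outArcs-unique : Unique (map outArc (allFin (n G)))
    outArcs-unique = Unique.map⁺ (cong proj₁) (Unique.allFin⁺ (n G))
    outArcs⊆arcs : map outArc (allFin (n G)) ⊆ arcs G
    outArcs⊆arcs a∈ with x , _ , refl ← ∈-map⁻ outArc a∈ = ∈-arcs⁺ (proj₂ (out x))

module _ {G : Digraph} where

  infixr 5 _++ʷ_
  _++ʷ_ : ∀ {x y z i j} → Walk G x y i → Walk G y z j → Walk G x z (i + j)
  nil      ++ʷ q = q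
  cons a p ++ʷ q = cons a (p ++ʷ q)

  infixl 5 _∷ʳ_
  _∷ʳ_ : ∀ {x y z k} → Walk G x y k → Arc G y z → Walk G x z (suc k)
  nil      ∷ʳ a = cons a nil
  cons b p ∷ʳ a = cons b (p ∷ʳ a)

  splitWalk : ∀ {x z} i j → Walk G x z (i + j) → ∃[ y ] Walk G x y i × Walk G y z j
  splitWalk zero    j p          = _ , nil , p
  splitWalk (suc i) j (cons a p) with y , p₁ , p₂ ← splitWalk i j p = y , cons a p₁ , p₂

  Walk-zero : ∀ {x y} → Walk G x y 0 → x ≡ y
  Walk-zero nil = refl

  Dist-refl : ∀ {x} → Dist G x x 0
  Dist-refl = nil , λ _ ()

  Dist-minimal : ∀ {x y k m} → Dist G x y k → Walk G x y m → k ≤ m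
  Dist-minimal (_ , shortest) p = ≮⇒≥ (λ m<k → shortest _ m<k p)

  Dist-unique : ∀ {x y k l} → Dist G x y k → Dist G x y l → k ≡ l
  Dist-unique dk dl = ≤-antisym (Dist-minimal dk (proj₁ dl)) (Dist-minimal dl (proj₁ dk))

  Dist-⇔ : ∀ {x y x′ y′ m} → Dist G x y m → Dist G x′ y′ m → ∀ k → Dist G x y k ⇔ Dist G x′ y′ k
  Dist-⇔ dm dm′ k = mk⇔ (λ dk → subst (Dist G _ _) (Dist-unique dm dk) dm′)
                        (λ dk → subst (Dist G _ _) (Dist-unique dm′ dk) dm)

  Dist-suc⇒≢ : ∀ {x y k} → Dist G x y (suc k) → x ≢ y
  Dist-suc⇒≢ d refl with () ← Dist-minimal d nil

  Dist-prefix : ∀ {x z k i} → Dist G x z k → i ≤ k → ∃[ y ] Dist G x y i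
  Dist-prefix {x} {z} {k} {i} (p , shortest) i≤k
    with y , p₁ , p₂ ← splitWalk i (k ∸ i) (subst (Walk G x z) (sym (m+[n∸m]≡n i≤k)) p) =
    y , p₁ , λ j j<i q → shortest (j + (k ∸ i))
      (subst (j + (k ∸ i) <_) (m+[n∸m]≡n i≤k) (+-monoˡ-< (k ∸ i) j<i)) (q ++ʷ p₂)

  Dist⇒suc≤n : ∀ {x z k} → Dist G x z k → suc k ≤ n G
  Dist⇒suc≤n {x} {k = k} d = injective⇒≤ {f = vertexAt} vertexAt-injective
    where
    vertexAt : Fin (suc k) → V G
    vertexAt i = proj₁ (Dist-prefix d (toℕ≤pred[n] i))
    vertexAt-injective : ∀ {i j} → vertexAt i ≡ vertexAt j → i ≡ j
    vertexAt-injective {i} {j} eq = toℕ-injective (Dist-unique (proj₂ (Dist-prefix d (toℕ≤pred[n] i)))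
      (subst (λ v → Dist G x v (toℕ j)) (sym eq) (proj₂ (Dist-prefix d (toℕ≤pred[n] j)))))

  out-neighbour : StronglyConnected G → (∀ x → ∃[ y ] x ≢ y) → ∀ x → ∃[ y ] Arc G x y
  out-neighbour sc other x with other x
  ... | y , x≢y with sc x y
  ...   | zero  , p        = ⊥-elim (x≢y (Walk-zero p))
  ...   | suc _ , cons a _ = _ , a

decode : ∀ {d} → GammaV d → ℕ × ℕ
decode nothing         = 0 , 0
decode (just (i , j)) = suc (toℕ i) , suc (toℕ j)

decode-injective : ∀ {d} {p q : GammaV d} → decode p ≡ decode q → p ≡ q
decode-injective {p = nothing}      {nothing}       _  = refl
decode-injective {p = just (i , j)} {just (k , l)} eq
  with refl ← toℕ-injective (suc-injective (cong proj₁ eq))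
     | refl ← toℕ-injective (suc-injective (cong proj₂ eq)) = refl

GammaStep : ℕ × ℕ → ℕ × ℕ → Set
GammaStep (a₁ , a₂) (b₁ , b₂) = b₁ ≤ suc a₁ × a₂ ≤ suc b₂

GammaStep⇒GammaArc : ∀ {d} (p q : GammaV d) → p ≢ q → GammaStep (decode p) (decode q) → GammaArc d p q
GammaStep⇒GammaArc nothing        nothing        p≢q _                 = p≢q refl
GammaStep⇒GammaArc nothing        (just _)       _   (s≤s i≤0 , _)     = n≤0⇒n≡0 i≤0
GammaStep⇒GammaArc (just _)       nothing        _   (_ , s≤s j≤0)     = n≤0⇒n≡0 j≤0
GammaStep⇒GammaArc (just a)       (just b)       p≢q (s≤s l₁ , s≤s l₂) = p≢q ∘ cong just , l₁ , l₂

allGammaV : ∀ d → List (GammaV d)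
allGammaV d = nothing ∷ map just (cartesianProduct (allFin d) (allFin d))

∈-allGammaV : ∀ {d} (p : GammaV d) → p ∈ allGammaV d
∈-allGammaV nothing        = here refl
∈-allGammaV (just (i , j)) = there (∈-map⁺ just (∈-cartesianProduct⁺ (∈-allFin i) (∈-allFin j)))

embedded⇒n≤ : ∀ {G d} → EmbedsInGamma G d → n G ≤ d * d + 1
embedded⇒n≤ {G} {d} (f , f-injective , _) = begin
  n G                            ≡⟨ sym (length-allFin (n G)) ⟩
  length (allFin (n G))          ≡⟨ sym (length-map f (allFin (n G))) ⟩
  length (map f (allFin (n G)))  ≤⟨ length-mono-⊆ (Unique.map⁺ f-injective (Unique.allFin⁺ (n G)))
                                                   (λ _ → ∈-allGammaV _) ⟩
  length (allGammaV d)           ≡⟨ cong suc length-pairs ⟩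
  suc (d * d)                    ≡⟨ +-comm 1 (d * d) ⟩
  d * d + 1                      ∎
  where
  open ≤-Reasoning
  length-pairs : length (map just (cartesianProduct (allFin d) (allFin d))) ≡ d * d
  length-pairs = trans (length-map just (cartesianProduct (allFin d) (allFin d)))
    (trans (length-cartesianProduct (allFin d) (allFin d)) (cong₂ _*_ (length-allFin d) (length-allFin d)))

-- band k = {(a , b) ∈ [1 , d]² ∣ b ≤ a + 1} for d = k + 1; it has c = (d² + 3d − 2)/2 elements.
band : ℕ → List (ℕ × ℕ)
band zero    = (1 , 1) ∷ []
band (suc k) = (suc k , suc (suc k)) ∷ map (λ b → suc (suc k) , suc b) (upTo (suc (suc k))) ++ band k

∈-band : ∀ k {a b} → a ≤ k → b ≤ k → b ≤ suc a → (suc a , suc b) ∈ band k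
∈-band zero    z≤n      z≤n      _     = here refl
∈-band (suc k) a≤1+k b≤1+k b≤1+a with m≤n⇒m<n∨m≡n a≤1+k | m≤n⇒m<n∨m≡n b≤1+k
... | inj₂ refl      | _              = there (∈-++⁺ˡ (∈-map⁺ _ (∈-upTo⁺ (s≤s b≤1+k))))
... | inj₁ (s≤s a≤k) | inj₁ (s≤s b≤k) = there (∈-++⁺ʳ _ (∈-band k a≤k b≤k b≤1+a))
... | inj₁ (s≤s a≤k) | inj₂ refl      =
  here (cong (λ x → suc x , suc (suc k)) (≤-antisym a≤k (s≤s⁻¹ b≤1+a)))

length-band : ∀ k → length (band k) * 2 + 2 ≡ suc k * suc k + 3 * suc k
length-band zero    = refl
length-band (suc k) = begin
  length (band (suc k)) * 2 + 2                  ≡⟨ cong (λ l → l * 2 + 2) length-step ⟩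
  (3 + k + length (band k)) * 2 + 2              ≡⟨ regroup k (length (band k)) ⟩
  (length (band k) * 2 + 2) + 2 * k + 6          ≡⟨ cong (λ m → m + 2 * k + 6) (length-band k) ⟩
  (1 + k) * (1 + k) + 3 * (1 + k) + 2 * k + 6    ≡⟨ square-step k ⟩
  (2 + k) * (2 + k) + 3 * (2 + k)                ∎
  where
  open ≡-Reasoning
  length-step : length (band (suc k)) ≡ 3 + k + length (band k)
  length-step = cong suc (trans (length-++ (map _ (upTo (2 + k))))
    (cong (_+ length (band k)) (trans (length-map _ (upTo (2 + k))) (length-upTo (2 + k)))))
  regroup : ∀ k l → (3 + k + l) * 2 + 2 ≡ (l * 2 + 2) + 2 * k + 6
  regroup = solve-∀
  square-step : ∀ k → (1 + k) * (1 + k) + 3 * (1 + k) + 2 * k + 6 ≡ (2 + k) * (2 + k) + 3 * (2 + k)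
  square-step = solve-∀

length-band≡ : ∀ k → length (band k) ≡ (suc k * suc k + 3 * suc k ∸ 2) / 2
length-band≡ k = sym (begin
  (suc k * suc k + 3 * suc k ∸ 2) / 2   ≡⟨ cong (λ m → (m ∸ 2) / 2) (sym (length-band k)) ⟩
  (length (band k) * 2 + 2 ∸ 2) / 2    ≡⟨ cong (_/ 2) (m+n∸n≡m (length (band k) * 2) 2) ⟩
  length (band k) * 2 / 2              ≡⟨ m*n/n≡m (length (band k)) 2 ⟩
  length (band k)                      ∎)
  where open ≡-Reasoning

Pair² : Set
Pair² = (ℕ × ℕ) × (ℕ × ℕ)

bandPairArc : Pair² → Pair²
bandPairArc ((a₁ , b₁) , (b₂ , a₂)) = (a₁ , a₂) , (b₁ , b₂)

bandSquare : ℕ → List Pair²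
bandSquare k = map bandPairArc (cartesianProduct (band k) (band k))

arcFromHub arcToHub : ℕ → Pair²
arcFromHub b = (0 , 0) , (1 , suc b)
arcToHub   a = (suc a , 1) , (0 , 0)

hubArcs : ℕ → List Pair²
hubArcs k = map arcFromHub (upTo (suc k)) ++ map arcToHub (upTo (suc k))

gammaArcCover : ℕ → List Pair²
gammaArcCover k = hubArcs k ++ bandSquare k

length-gammaArcCover : ∀ k → length (gammaArcCover k) ≡ suc k + suc k + length (band k) * length (band k)
length-gammaArcCover k = begin
  length (hubArcs k ++ bandSquare k)                   ≡⟨ length-++ (hubArcs k) ⟩
  length (hubArcs k) + length (bandSquare k)           ≡⟨ cong₂ _+_ length-hub length-square ⟩
  suc k + suc k + length (band k) * length (band k)    ∎
  where
  open ≡-Reasoning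
  length-upTo-map : ∀ (f : ℕ → Pair²) → length (map f (upTo (suc k))) ≡ suc k
  length-upTo-map f = trans (length-map f (upTo (suc k))) (length-upTo (suc k))
  length-hub : length (hubArcs k) ≡ suc k + suc k
  length-hub = trans (length-++ (map arcFromHub (upTo (suc k))))
                     (cong₂ _+_ (length-upTo-map arcFromHub) (length-upTo-map arcToHub))
  length-square : length (bandSquare k) ≡ length (band k) * length (band k)
  length-square = trans (length-map bandPairArc (cartesianProduct (band k) (band k)))
                        (length-cartesianProduct (band k) (band k))

∈-bandSquare : ∀ k {a₁ a₂ b₁ b₂} → a₁ ≤ k → a₂ ≤ k → b₁ ≤ k → b₂ ≤ k → b₁ ≤ suc a₁ → a₂ ≤ suc b₂ →
  ((suc a₁ , suc a₂) , (suc b₁ , suc b₂)) ∈ bandSquare k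
∈-bandSquare k a₁≤k a₂≤k b₁≤k b₂≤k b₁≤1+a₁ a₂≤1+b₂ =
  ∈-map⁺ bandPairArc (∈-cartesianProduct⁺ (∈-band k a₁≤k b₁≤k b₁≤1+a₁)
                                          (∈-band k b₂≤k a₂≤k a₂≤1+b₂))

module _ {k : ℕ} where

  ∈-gammaArcCover-arc : ∀ {p q : GammaV (suc k)} → GammaArc (suc k) p q → (decode p , decode q) ∈ gammaArcCover k
  ∈-gammaArcCover-arc {nothing} {just (i , j)} i≡0 rewrite i≡0 =
    ∈-++⁺ˡ (∈-++⁺ˡ (∈-map⁺ arcFromHub (∈-upTo⁺ (toℕ<n j))))
  ∈-gammaArcCover-arc {just (i , j)} {nothing} j≡0 rewrite j≡0 =
    ∈-++⁺ˡ (∈-++⁺ʳ (map arcFromHub (upTo (suc k))) (∈-map⁺ arcToHub (∈-upTo⁺ (toℕ<n i))))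
  ∈-gammaArcCover-arc {just (i₁ , i₂)} {just (j₁ , j₂)} (_ , j₁≤1+i₁ , i₂≤1+j₂) =
    ∈-++⁺ʳ (hubArcs k) (∈-bandSquare k (toℕ≤pred[n] i₁) (toℕ≤pred[n] i₂) (toℕ≤pred[n] j₁) (toℕ≤pred[n] j₂)
                                       j₁≤1+i₁ i₂≤1+j₂)

  ∈-gammaArcCover-loop : ∀ (a : Fin (suc k) × Fin (suc k)) → (decode (just a) , decode (just a)) ∈ gammaArcCover k
  ∈-gammaArcCover-loop (i , j) =
    ∈-++⁺ʳ (hubArcs k) (∈-bandSquare k (toℕ≤pred[n] i) (toℕ≤pred[n] j) (toℕ≤pred[n] i) (toℕ≤pred[n] j)
                                       (n≤1+n (toℕ i)) (n≤1+n (toℕ j)))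

module EmbeddedArcs {G : Digraph} {k : ℕ} (f : V G → GammaV (suc k)) (f-injective : Injective _≡_ _≡_ f)
                    (f-arc : ∀ x y → Arc G x y → GammaArc (suc k) (f x) (f y)) where

  decodeArc : V G × V G → Pair²
  decodeArc (x , y) = decode (f x) , decode (f y)

  decodeLoop : Fin (suc k) × Fin (suc k) → Pair²
  decodeLoop a = decode (just a) , decode (just a)

  images loops : List Pair²
  images = map decodeArc (arcs G)
  loops  = map decodeLoop (cartesianProduct (allFin (suc k)) (allFin (suc k)))

  decode∘f-injective : ∀ {x y} → decode (f x) ≡ decode (f y) → x ≡ y
  decode∘f-injective = f-injective ∘ decode-injective

  images-unique : Unique images
  images-unique = Unique.map⁺ (λ eq → cong₂ _,_ (decode∘f-injective (cong proj₁ eq))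
                                                 (decode∘f-injective (cong proj₂ eq)))
                              (arcs-unique G)

  loops-unique : Unique loops
  loops-unique = Unique.map⁺ (just-injective ∘ decode-injective ∘ cong proj₁)
                             (Unique.cartesianProduct⁺ (Unique.allFin⁺ (suc k)) (Unique.allFin⁺ (suc k)))

  images-loops-disjoint : Disjoint images loops
  images-loops-disjoint (v∈images , v∈loops)
    with (x , y) , xy∈arcs , refl ← ∈-map⁻ decodeArc v∈images | _ , _ , eq ← ∈-map⁻ decodeLoop v∈loops =
    Arc-irreflexive G (subst (Arc G x) (sym (decode∘f-injective (trans (cong proj₁ eq) (sym (cong proj₂ eq)))))
                                     (∈-arcs⁻ G xy∈arcs))

  images-loops⊆cover : images ++ loops ⊆ gammaArcCover k
  images-loops⊆cover v∈ with ∈-++⁻ images v∈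
  ... | inj₁ v∈images with (x , y) , xy∈arcs , refl ← ∈-map⁻ decodeArc v∈images =
    ∈-gammaArcCover-arc (f-arc x y (∈-arcs⁻ G xy∈arcs))
  ... | inj₂ v∈loops with a , _ , refl ← ∈-map⁻ decodeLoop v∈loops = ∈-gammaArcCover-loop a

  arcCount+square≤ : arcCount G + suc k * suc k ≤ suc k + suc k + length (band k) * length (band k)
  arcCount+square≤ = begin
    arcCount G + suc k * suc k         ≡⟨ cong₂ _+_ length-images (sym length-loops) ⟩
    length images + length loops       ≡⟨ sym (length-++ images) ⟩
    length (images ++ loops)           ≤⟨ length-mono-⊆ (Unique.++⁺ images-unique loops-unique images-loops-disjoint)
                                                        images-loops⊆cover ⟩
    length (gammaArcCover k)           ≡⟨ length-gammaArcCover k ⟩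
    suc k + suc k + length (band k) * length (band k) ∎
    where
    open ≤-Reasoning
    length-images : arcCount G ≡ length images
    length-images = trans (arcCount≡length-arcs G) (sym (length-map decodeArc (arcs G)))
    length-loops : length loops ≡ suc k * suc k
    length-loops = trans (length-map decodeLoop (cartesianProduct (allFin (suc k)) (allFin (suc k))))
      (trans (length-cartesianProduct (allFin (suc k)) (allFin (suc k)))
             (cong₂ _*_ (length-allFin (suc k)) (length-allFin (suc k))))

embedded⇒arcCount+square≤ : ∀ {G k} → EmbedsInGamma G (suc k) →
  arcCount G + suc k * suc k ≤ suc k + suc k + length (band k) * length (band k)
embedded⇒arcCount+square≤ {G} {k} (f , f-injective , f-arc) = EmbeddedArcs.arcCount+square≤ {G} {k} f f-injective f-arc

ℕ-bound⇒ℤ-bound : ∀ {m c d} → m + d * d ≤ d + d + c * c → + m ≤ℤ + c *ℤ + c +ℤ + d *ℤ (+ 2 -ℤ + d)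
ℕ-bound⇒ℤ-bound {m} {c} {d} bound = begin
  + m                                           ≡⟨ add-sub (+ m) (+ d) ⟩
  + m +ℤ + d *ℤ + d -ℤ + d *ℤ + d              ≤⟨ ℤ.+-monoˡ-≤ (-ℤ (+ d *ℤ + d)) lifted ⟩
  + d +ℤ + d +ℤ + c *ℤ + c -ℤ + d *ℤ + d       ≡⟨ regroup (+ c) (+ d) ⟩
  + c *ℤ + c +ℤ + d *ℤ (+ 2 -ℤ + d)            ∎
  where
  open ℤ.≤-Reasoning
  lifted : + m +ℤ + d *ℤ + d ≤ℤ + d +ℤ + d +ℤ + c *ℤ + c
  lifted = subst₂ _≤ℤ_ (trans (ℤ.pos-+ m (d * d)) (cong (+ m +ℤ_) (ℤ.pos-* d d)))
                       (trans (ℤ.pos-+ (d + d) (c * c)) (cong₂ _+ℤ_ (ℤ.pos-+ d d) (ℤ.pos-* c c)))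
                       (+≤+ bound)
  add-sub : ∀ x y → x ≡ x +ℤ y *ℤ y -ℤ y *ℤ y
  add-sub = ℤsolve-∀
  regroup : ∀ c d → d +ℤ d +ℤ c *ℤ c -ℤ d *ℤ d ≡ c *ℤ c +ℤ d *ℤ (+ 2 -ℤ d)
  regroup = ℤsolve-∀

fromℕ-pred : ∀ {m d} → 1 ≤ m → m ≤ d → Fin d
fromℕ-pred {suc m} _ m<d = fromℕ< m<d

suc-toℕ-fromℕ-pred : ∀ {m d} (1≤m : 1 ≤ m) (m≤d : m ≤ d) → suc (toℕ (fromℕ-pred 1≤m m≤d)) ≡ m
suc-toℕ-fromℕ-pred {suc m} _ m<d = cong suc (toℕ-fromℕ< m<d)

dim₁⇒resolving-vertex : ∀ {G} → HasDim G 1 → ∃[ w ] WeaklyResolving G (w ∷ [])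
dim₁⇒resolving-vertex ((w ∷ [] , _ , resolving , refl) , _) = w , resolving

module ResolvingVertex {G : Digraph} {d : ℕ} (diameter : HasDiameter G d)
                       {w : V G} (resolving : WeaklyResolving G (w ∷ [])) where

  ∂ : V G → V G → ℕ
  ∂ x y = proj₁ (proj₁ diameter x y)

  ∂-Dist : ∀ x y → Dist G x y (∂ x y)
  ∂-Dist x y = proj₁ (proj₂ (proj₁ diameter x y))

  ∂≤d : ∀ x y → ∂ x y ≤ d
  ∂≤d x y = proj₂ (proj₂ (proj₁ diameter x y))

  ∂-self : ∀ x → ∂ x x ≡ 0
  ∂-self x = Dist-unique (∂-Dist x x) Dist-refl

  ∂-positive : ∀ {x y} → x ≢ y → 1 ≤ ∂ x y
  ∂-positive {x} {y} x≢y =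
    n≢0⇒n>0 λ ∂≡0 → x≢y (Walk-zero (subst (Walk G x y) ∂≡0 (proj₁ (∂-Dist x y))))

  profile : V G → ℕ × ℕ
  profile x = ∂ w x , ∂ x w

  profile-injective : ∀ {x y} → profile x ≡ profile y → x ≡ y
  profile-injective {x} {y} eq =
    decidable-stable (x ≟ᶠ y) λ x≢y → resolving x y x≢y λ { _ (here refl) → sameDistPair }
    where
    sameDistPair : SameDistPair G w x y
    sameDistPair = Dist-⇔ (∂-Dist w x) (subst (Dist G w y) (sym (cong proj₁ eq)) (∂-Dist w y))
                 , Dist-⇔ (∂-Dist x w) (subst (Dist G y w) (sym (cong proj₂ eq)) (∂-Dist y w))

  profile-step : ∀ {x y} → Arc G x y → GammaStep (profile x) (profile y)
  profile-step {x} {y} a = Dist-minimal (∂-Dist w y) (proj₁ (∂-Dist w x) ∷ʳ a)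
                         , Dist-minimal (∂-Dist x w) (cons a (proj₁ (∂-Dist y w)))

  f : V G → GammaV d
  f x with x ≟ᶠ w
  ... | yes _   = nothing
  ... | no x≢w = just ( fromℕ-pred (∂-positive (x≢w ∘ sym)) (∂≤d w x)
                      , fromℕ-pred (∂-positive x≢w) (∂≤d x w))

  decode∘f≡profile : ∀ x → decode (f x) ≡ profile x
  decode∘f≡profile x with x ≟ᶠ w
  ... | yes refl = cong₂ _,_ (sym (∂-self w)) (sym (∂-self w))
  ... | no x≢w  = cong₂ _,_ (suc-toℕ-fromℕ-pred _ (∂≤d w x)) (suc-toℕ-fromℕ-pred _ (∂≤d x w))

  f-injective : Injective _≡_ _≡_ f
  f-injective {x} {y} eq =
    profile-injective (trans (sym (decode∘f≡profile x)) (trans (cong decode eq) (decode∘f≡profile y)))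

  f-arc : ∀ x y → Arc G x y → GammaArc d (f x) (f y)
  f-arc x y a = GammaStep⇒GammaArc (f x) (f y)
    (λ fx≡fy → Arc-irreflexive G (subst (Arc G x) (sym (f-injective fx≡fy)) a))
    (subst₂ GammaStep (sym (decode∘f≡profile x)) (sym (decode∘f≡profile y)) (profile-step a))

  embedding : EmbedsInGamma G d
  embedding = f , f-injective , f-arc

proposition3p1 : (d : ℕ) → 1 ≤ d → (G : Digraph) →
    StronglyConnected G → HasDim G 1 → HasDiameter G d →
    EmbedsInGamma G d ×
    (d + 1 ≤ n G × n G ≤ d * d + 1) ×
    (d + 1 ≤ arcCount G ×
    (+ arcCount G) ≤ℤ (+ ((d * d + 3 * d ∸ 2) / 2)) *ℤ (+ ((d * d + 3 * d ∸ 2) / 2))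
    +ℤ (+ d) *ℤ ((+ 2) -ℤ (+ d)))
proposition3p1 (suc k) _ G strongly-connected dim diameter@(_ , _ , _ , diametral)
  with _ , resolving ← dim₁⇒resolving-vertex dim =
  embedding , (d+1≤n , embedded⇒n≤ {G} embedding) , (≤-trans d+1≤n (n≤arcCount G out-neighbours) , arc-bound)
  where
  open ResolvingVertex diameter resolving
  d+1≤n : suc k + 1 ≤ n G
  d+1≤n = subst (_≤ n G) (+-comm 1 (suc k)) (Dist⇒suc≤n diametral)
  out-neighbours : ∀ x → ∃[ y ] Arc G x y
  out-neighbours = out-neighbour strongly-connected (distinct⇒other _≟ᶠ_ (Dist-suc⇒≢ diametral))
  c : ℕ
  c = (suc k * suc k + 3 * suc k ∸ 2) / 2
  arc-bound : + arcCount G ≤ℤ + c *ℤ + c +ℤ + suc k *ℤ (+ 2 -ℤ + suc k)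
  arc-bound = ℕ-bound⇒ℤ-bound {c = c} {d = suc k}
    (subst (λ l → arcCount G + suc k * suc k ≤ suc k + suc k + l * l) (length-band≡ k)
           (embedded⇒arcCount+square≤ {G} embedding))
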